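{- For any binary string $S$ and $d\in\mathbb{N}$, if $VCdim(S)\geq d+1$ then $SWdim(S)\geq d$.
   Context: For a finite binary string $s$ (indexed from $0$), let $n(s)=\{i: s_i=1\}\subseteq\mathbb{N}$. For a binary string $S$, let $\mathfrak{S}=\{n(s): s \text{ a finite contiguous substring of } S\}$ and, for $w\in\mathbb{N}$, $\mathfrak{S}_w=\{n(s): s \text{ a substring of } S \text{ of length } w\}$. The VC dimension of a family $\mathcal{C}$ of subsets of $\mathbb{N}$ is the largest size of a set $B$ with $\{c\cap B: c\in\mathcal{C}\}$ equal to the power set of $B$ ($\infty$ if none is largest). $VCdim(S)$ is the VC dimension of $\mathfrak{S}$, and $SWdim(S)=\max\{VCdim(\mathfrak{S}_w): w\in\mathbb{N}\}$ ($\infty$ if no maximum exists). -}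

module Defs where

open import Data.Nat using (ℕ; zero; suc; _+_; _≤_; _<_)
open import Data.Bool using (Bool; true; false)
open import Data.List using (List; []; _∷_; length)
open import Data.List.Membership.Propositional using (_∈_)
open import Data.List.Relation.Unary.Unique.Propositional using (Unique)
open import Data.Product using (Σ; _×_; ∃; ∃-syntax)
open import Data.Unit using (⊤)
open import Function.Bundles using (_⇔_)
open import Relation.Binary.PropositionalEquality using (_≡_)

data BinString : Set where
  finite   : List Bool → BinString
  infinite : (ℕ → Bool) → BinString

-- bit of a list at a position (default false out of range; only ever
-- used in range, see `Fits`)
lookupBit : List Bool → ℕ → Bool
lookupBit []       _       = false
lookupBit (b ∷ bs) zero    = b
lookupBit (b ∷ bs) (suc i) = lookupBit bs i

bit : BinString → ℕ → Bool
bit (finite l)   i = lookupBit l i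
bit (infinite f) i = f i

Fits : BinString → ℕ → ℕ → Set
Fits (finite l)   k w = k + w ≤ length l
Fits (infinite f) k w = ⊤

-- i ∈ n(s) where s is the substring of S of length w starting at k.
InN : BinString → ℕ → ℕ → ℕ → Set
InN S k w i = i < w × bit S (k + i) ≡ true

record Family : Set₁ where
  field
    Idx : Set
    mem : Idx → ℕ → Set

-- 𝔖 : all n(s), s a finite contiguous substring of S (indexed by start, length).
𝔖 : BinString → Family
𝔖 S = record { Idx = Σ (ℕ × ℕ) (λ p → Fits S (Data.Product.proj₁ p) (Data.Product.proj₂ p))
             ; mem = λ c i → InN S (Data.Product.proj₁ (Data.Product.proj₁ c))
                                   (Data.Product.proj₂ (Data.Product.proj₁ c)) i }

𝔖[_] : ℕ → BinString → Family
𝔖[ w ] S = record { Idx = Σ ℕ (λ k → Fits S k w)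
                  ; mem = λ c i → InN S (Data.Product.proj₁ c) w i }

-- The finite set B (a duplicate-free list) is shattered by C: every subset
-- of B (given as the trace on B of a predicate f) equals c ∩ B for some c ∈ C.
Shatters : Family → List ℕ → Set
Shatters C B = (f : ℕ → Bool) → ∃[ c ] (∀ i → i ∈ B → (Family.mem C c i ⇔ (f i ≡ true)))
  where open Family C using (Idx)

-- VC dimension of C is ≥ m (m ≤ VCdim, with VCdim possibly ∞):
-- some shattered set has size at least m.
VCdim≥ : Family → ℕ → Set
VCdim≥ C m = ∃[ B ] (Unique B × m ≤ length B × Shatters C B)

VCdimS≥ : BinString → ℕ → Set
VCdimS≥ S m = VCdim≥ (𝔖 S) m

-- SWdim(S) ≥ m, where SWdim(S) = max_w VCdim(𝔖_w) (∞ if no max):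
-- equivalently some w has VCdim(𝔖_w) ≥ m.
SWdim≥ : BinString → ℕ → Set
SWdim≥ S m = ∃[ w ] VCdim≥ (𝔖[ w ] S) m

{-# OPTIONS --safe #-}
module Submission where

open import Defs
open import Data.Nat using (ℕ; suc; _≤_; _<_; _≟_; _<?_; s≤s; z≤n)
open import Data.Nat.Properties
  using (≤-trans; ≤-reflexive; ≤-pred; ≤-antisym; <⇒≤; <⇒≢; ≮⇒≥; ≤∧≢⇒<; +-monoʳ-≤)
open import Data.Bool using (Bool; true; _∨_)
open import Data.Bool.Properties using (∨-zeroʳ; ∨-identityʳ)
open import Data.List using (List; []; _∷_; length; filter)
open import Data.List.Properties using (filter-all; filter-accept; filter-reject)
open import Data.List.Extrema.Nat using (max; argmax-sel; ⊥≤max; xs≤max)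
open import Data.List.Membership.Propositional using (_∈_)
open import Data.List.Membership.Propositional.Properties using (∈-filter⁻)
open import Data.List.Relation.Binary.Subset.Propositional using (_⊆_)
open import Data.List.Relation.Unary.Any using (here; there)
open import Data.List.Relation.Unary.All as All using (All; []; _∷_)
open import Data.List.Relation.Unary.AllPairs using ([]; _∷_)
open import Data.List.Relation.Unary.Unique.Propositional using (Unique)
open import Data.List.Relation.Unary.Unique.Propositional.Properties as Unique using ()
open import Data.Product using (_,_; proj₁; proj₂)
open import Data.Sum using (inj₁; inj₂)
open import Data.Unit using (tt)
open import Function.Bundles using (_⇔_; mk⇔; Equivalence)
open import Relation.Nullary using (yes; no)
open import Relation.Nullary.Decidable using (does; dec-true; dec-false)
open import Relation.Binary.PropositionalEquality using (_≡_; _≢_; refl; sym; trans; subst; cong)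

-- Let m be the largest element of a shattered set B.  The substrings realising
-- the subsets of B that contain m all extend past position m, so their prefixes
-- of the fixed length m + 1 realise every subset of B ∖ {m}: the sliding-window
-- family of width m + 1 shatters a set of size |B| − 1.

Fits-mono : ∀ S k {w w′} → w ≤ w′ → Fits S k w′ → Fits S k w
Fits-mono (finite l)   k w≤w′ fits = ≤-trans (+-monoʳ-≤ k w≤w′) fits
Fits-mono (infinite g) k w≤w′ fits = tt

InN-window : ∀ S k {w w′ i} → i < w′ → InN S k w i → InN S k w′ i
InN-window S k i<w′ (_ , bit≡true) = i<w′ , bit≡true

Shatters-⊆ : ∀ C {A B} → A ⊆ B → Shatters C B → Shatters C A
Shatters-⊆ C A⊆B shB f with shB f
... | c , agree = c , λ i i∈A → agree i (A⊆B i∈A)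

length≤1+length-filter-< : ∀ m {xs} → Unique xs → All (_≤ m) xs →
                           length xs ≤ suc (length (filter (_<? m) xs))
length≤1+length-filter-< m {[]}     []         []           = z≤n
length≤1+length-filter-< m {x ∷ xs} (x∉xs ∷ u) (x≤m ∷ xs≤m) with x <? m
... | yes x<m rewrite filter-accept (_<? m) {x} {xs} x<m =
  s≤s (length≤1+length-filter-< m u xs≤m)
... | no x≮m rewrite filter-reject (_<? m) {x} {xs} x≮m =
  s≤s (≤-reflexive (sym (cong length (filter-all (_<? m) xs<m))))
  where
    x≡m : x ≡ m
    x≡m = ≤-antisym x≤m (≮⇒≥ x≮m)

    xs<m : All (_< m) xs
    xs<m = All.zipWith (λ (y≤m , x≢y) → ≤∧≢⇒< y≤m λ y≡m → x≢y (trans x≡m (sym y≡m)))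
                       (xs≤m , x∉xs)

_∪｛_｝ : (ℕ → Bool) → ℕ → ℕ → Bool
(f ∪｛ m ｝) i = f i ∨ does (i ≟ m)

∪｛｝-self : ∀ f m → (f ∪｛ m ｝) m ≡ true
∪｛｝-self f m =
  subst (λ b → f m ∨ b ≡ true) (sym (dec-true (m ≟ m) refl)) (∨-zeroʳ (f m))

∪｛｝-other : ∀ f {m i} → i ≢ m → (f ∪｛ m ｝) i ≡ f i
∪｛｝-other f {m} {i} i≢m =
  subst (λ b → f i ∨ b ≡ f i) (sym (dec-false (i ≟ m) i≢m)) (∨-identityʳ (f i))

shatters-window : ∀ S {m B} → All (_< m) B →
                  Shatters (𝔖 S) (m ∷ B) → Shatters (𝔖[ suc m ] S) B
shatters-window S {m} {B} B<m shm∷B f with shm∷B (f ∪｛ m ｝)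
... | ((k , w) , fits) , realises = (k , Fits-mono S k m<w fits) , agree
  where
    m<w : m < w
    m<w = proj₁ (Equivalence.from (realises m (here refl)) (∪｛｝-self f m))

    agree : ∀ i → i ∈ B → InN S k (suc m) i ⇔ (f i ≡ true)
    agree i i∈B = mk⇔
      (λ i∈c → trans (sym f∪m≡f) (to (InN-window S k (≤-trans i<m (<⇒≤ m<w)) i∈c)))
      (λ fi → InN-window S k (s≤s (<⇒≤ i<m)) (from (trans f∪m≡f fi)))
      where
        i<m : i < m
        i<m = All.lookup B<m i∈B

        f∪m≡f : (f ∪｛ m ｝) i ≡ f i
        f∪m≡f = ∪｛｝-other f (<⇒≢ i<m)

        open Equivalence (realises i (there i∈B))

proposition2 : (S : BinString) (d : ℕ) → VCdimS≥ S (suc d) → SWdim≥ S d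
proposition2 S d ([] , _ , () , _)
proposition2 S d (x ∷ xs , unique , 1+d≤|B| , shB) =
  suc m , B′ , Unique.filter⁺ (_<? m) unique , d≤|B′| ,
  shatters-window S B′<m (Shatters-⊆ (𝔖 S) m∷B′⊆B shB)
  where
    B : List ℕ
    B = x ∷ xs

    m : ℕ
    m = max x xs

    B′ : List ℕ
    B′ = filter (_<? m) B

    B≤m : All (_≤ m) B
    B≤m = ⊥≤max x xs ∷ xs≤max x xs

    m∈B : m ∈ B
    m∈B with argmax-sel (λ y → y) x xs
    ... | inj₁ m≡x = here m≡x
    ... | inj₂ m∈xs = there m∈xs

    B′<m : All (_< m) B′
    B′<m = All.tabulate (λ i∈B′ → proj₂ (∈-filter⁻ (_<? m) i∈B′))

    m∷B′⊆B : (m ∷ B′) ⊆ B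
    m∷B′⊆B (here refl) = m∈B
    m∷B′⊆B (there i∈B′) = proj₁ (∈-filter⁻ (_<? m) i∈B′)

    d≤|B′| : d ≤ length B′
    d≤|B′| = ≤-pred (≤-trans 1+d≤|B| (length≤1+length-filter-< m unique B≤m))
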